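{- Let $G$ be a graph and $p\geq 2$ an integer. Let $I_G$ be the set of isolated vertices of $G$, and suppose that $G-I_G$ has at least $p$ vertices. Then $G$ is the competition-common enemy graph of a loopless digraph satisfying Conditions $C(p)$ and $C'(p)$ if and only if $G$ is (isomorphic to) $K_r\cup I_q$ with $r\geq p$ and $q\geq 2$.
   Context: All graphs and digraphs are finite; $K_r$ is the complete graph on $r$ vertices, $I_q$ the edgeless graph on $q$ vertices, and $\cup$ denotes disjoint union. A digraph is loopless if it has no arc of the form $(x,x)$. For a digraph $D$ and vertex $x$, $N^+_D(x)=\{v \mid (x,v)\in A(D)\}$ and $N^-_D(x)=\{v \mid (v,x)\in A(D)\}$. The competition-common enemy graph of $D$ is the simple undirected graph on $V(D)$ in which distinct $x,y$ are adjacent iff $N^+_D(x)\cap N^+_D(y)\neq\emptyset$ and $N^-_D(x)\cap N^-_D(y)\neq\emptyset$. For a vertex set $S$, $\mathcal{F}^+_D(S):=\{x\in S \mid N^+_D(x)\subseteq N^+_D(y)\ \forall y\in S\}$ and $\mathcal{F}^-_D(S):=\{x\in S \mid N^-_D(x)\subseteq N^-_D(y)\ \forall y\in S\}$. For an integer $p\geq2$, $D$ satisfies Condition $C(p)$ (resp. $C'(p)$) if $\mathcal{F}^+_D(S)\neq\emptyset$ (resp. $\mathcal{F}^-_D(S)\neq\emptyset$) for every set $S$ of exactly $p$ vertices of $D$. -}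

module Defs where

open import Data.Nat using (ℕ; _+_; _<ᵇ_)
open import Data.Bool using (Bool; true; false; _∧_; _∨_; not)
open import Data.Fin using (Fin; toℕ; _≟_)
open import Data.Fin.Subset using (Subset; _∈_; _⊆_; _∩_; Nonempty; ∣_∣)
open import Data.Vec using (tabulate; foldr)
open import Data.Product using (Σ; ∃; _×_)
open import Relation.Nullary using (¬_; does)
open import Relation.Binary.PropositionalEquality using (_≡_)
open import Function.Bundles using (_↔_; Inverse)

record Graph (n : ℕ) : Set where
  field
    adj    : Fin n → Fin n → Bool
    sym    : ∀ x y → adj x y ≡ adj y x
    irrefl : ∀ x → adj x x ≡ false
open Graph public

Digraph : ℕ → Set
Digraph n = Fin n → Fin n → Bool

Loopless : ∀ {n} → Digraph n → Set
Loopless D = ∀ x → D x x ≡ false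

N⁺ : ∀ {n} → Digraph n → Fin n → Subset n
N⁺ D x = tabulate (λ v → D x v)

N⁻ : ∀ {n} → Digraph n → Fin n → Subset n
N⁻ D x = tabulate (λ v → D v x)

IsCCEGraph : ∀ {n} → Graph n → Digraph n → Set
IsCCEGraph {n} G D =
  ∀ (x y : Fin n) → ¬ (x ≡ y) →
    (adj G x y ≡ true → Nonempty (N⁺ D x ∩ N⁺ D y) × Nonempty (N⁻ D x ∩ N⁻ D y))
    × (Nonempty (N⁺ D x ∩ N⁺ D y) × Nonempty (N⁻ D x ∩ N⁻ D y) → adj G x y ≡ true)

F⁺Nonempty : ∀ {n} → Digraph n → Subset n → Set
F⁺Nonempty {n} D S = ∃ λ (x : Fin n) → x ∈ S × (∀ y → y ∈ S → N⁺ D x ⊆ N⁺ D y)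

F⁻Nonempty : ∀ {n} → Digraph n → Subset n → Set
F⁻Nonempty {n} D S = ∃ λ (x : Fin n) → x ∈ S × (∀ y → y ∈ S → N⁻ D x ⊆ N⁻ D y)

CondC : ∀ {n} → ℕ → Digraph n → Set
CondC {n} p D = ∀ (S : Subset n) → ∣ S ∣ ≡ p → F⁺Nonempty D S

CondC' : ∀ {n} → ℕ → Digraph n → Set
CondC' {n} p D = ∀ (S : Subset n) → ∣ S ∣ ≡ p → F⁻Nonempty D S

Isolated : ∀ {n} → Graph n → Fin n → Set
Isolated G x = ∀ y → adj G x y ≡ false

anyFin : ∀ {m} → (Fin m → Bool) → Bool
anyFin f = foldr _ _∨_ false (tabulate f)

nonIsolated : ∀ {n} → Graph n → Subset n
nonIsolated G = tabulate (λ x → anyFin (λ y → adj G x y))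

KI-adj : (r q : ℕ) → Fin (r + q) → Fin (r + q) → Bool
KI-adj r q i j = (toℕ i <ᵇ r) ∧ (toℕ j <ᵇ r) ∧ not (does (i ≟ j))

IsoKI : ∀ {n} → Graph n → ℕ → ℕ → Set
IsoKI {n} G r q = Σ (Fin n ↔ Fin (r + q)) λ φ →
  ∀ x y → adj G x y ≡ KI-adj r q (Inverse.to φ x) (Inverse.to φ y)

module Submission where

-- Both directions go through the notion "G is a clique on K" (distinct
-- vertices are adjacent iff both lie in K), which is equivalent to
-- G ≅ K_∣K∣ ∪ I_∣∁K∣ via an order-preserving partition bijection.
--
-- (⇒) C(p) extends from p-sets to all larger sets (LeastElements), so the
-- non-isolated vertices W have a ⊆-least out-neighbourhood, and its prey a is
-- a common prey of W; dually (in the converse digraph) W has a common enemy b.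
-- Hence W is a clique.  The least vertex overall has no prey (looplessness),
-- so it is isolated; b is isolated too, and the two differ: ∣∁W∣ ≥ 2.
-- (⇐) With two isolated vertices a ≢ b, let every vertex of K ∪ {b} prey on a
-- and b prey on every vertex of K ∪ {a} (Construction).  Its converse is the
-- same construction with a and b exchanged, so C'(p) follows from C(p).

open import Defs
open import Data.Nat using (ℕ; _≤_)
open import Data.Fin.Subset using (∣_∣)
open import Data.Product using (∃; ∃₂; _×_)
open import Function.Bundles using (_⇔_)

open import Data.Nat using (zero; suc; _+_; _<_; _<ᵇ_; z≤n; s≤s; _∸_)
import Data.Nat.Properties as ℕₚ
open import Data.Bool using (Bool; true; false; _∧_)
open import Data.Bool.Properties using (T-≡; ⇔→≡; ∧-identityʳ; ∧-zeroʳ; ∨-zeroʳ)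
open import Data.Fin using (Fin; toℕ; join; splitAt; _↑ʳ_)
  renaming (zero to fzero; suc to fsuc; _≟_ to _≟ᶠ_)
import Data.Fin.Properties as Finₚ
open import Data.Fin.Subset
  using (Subset; inside; outside; _∈_; _∉_; _⊆_; _∩_; ∁; _-_; ⁅_⁆; ⊥; ⊤; Nonempty)
open import Data.Fin.Subset.Properties
  using (_∈?_; x∈p∩q⁺; x∈p∩q⁻; p⊆q⇒∣p∣≤∣q∣; ∣⁅x⁆∣≡1; x∈⁅y⁆⇒x≡y; x∉⁅y⁆⇒x≢y;
         ∈⊤; ∣⊥∣≡0; ∣⊤∣≡n; ∣p∣≤n; p─q⊆p; p─⊥≡p; x∈p∧x≢y⇒x∈p-y; x∉p⇒x∈∁p)
open import Data.Vec using (_∷_; tabulate; lookup; there)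
open import Data.Vec.Properties using (lookup∘tabulate; []=⇒lookup; lookup⇒[]=; tabulate-cong)
open import Data.Product using (_,_; proj₁; proj₂; swap)
import Data.Product as Product
open import Data.Sum using (_⊎_; inj₁; inj₂; [_,_]′)
import Data.Sum as Sum
open import Relation.Nullary using (¬_; Dec; yes; no; does; contradiction)
open import Relation.Nullary.Decidable using (_×-dec_; _⊎-dec_; ¬?; dec-true; dec-false)
open import Relation.Binary.PropositionalEquality
  using (_≡_; _≢_; refl; trans; cong; cong₂; subst; subst₂; module ≡-Reasoning)
  renaming (sym to ≡-sym)
open import Function.Base using (const; _∘_)
open import Function.Bundles using (Inverse; Injection; _↔_; mk↔ₛ′; mk⇔; Equivalence)
open import Function.Properties.Inverse using (↔⇒↣; ↔-sym)
import Function.Properties.Equivalence as ⇔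
open import Data.Product.Function.NonDependent.Propositional using (_×-⇔_)

∧-≡true : ∀ {x y : Bool} → x ∧ y ≡ true ⇔ (x ≡ true × y ≡ true)
∧-≡true = mk⇔ to from
  where
  to : ∀ {x y : Bool} → x ∧ y ≡ true → x ≡ true × y ≡ true
  to {true} {true} _ = refl , refl
  from : ∀ {x y : Bool} → x ≡ true × y ≡ true → x ∧ y ≡ true
  from (refl , refl) = refl

lookup⇔∈ : ∀ {n} (S : Subset n) (x : Fin n) → lookup S x ≡ true ⇔ x ∈ S
lookup⇔∈ S x = mk⇔ (lookup⇒[]= x S) []=⇒lookup

tabulate⇔∈ : ∀ {n} (f : Fin n → Bool) (x : Fin n) → f x ≡ true ⇔ x ∈ tabulate f
tabulate⇔∈ f x =
  subst (λ b → b ≡ true ⇔ x ∈ tabulate f) (lookup∘tabulate f x) (lookup⇔∈ (tabulate f) x)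

anyFin⇔∃ : ∀ {m} (f : Fin m → Bool) → anyFin f ≡ true ⇔ ∃ λ y → f y ≡ true
anyFin⇔∃ f = mk⇔ (to f) (λ (y , fy) → from f y fy)
  where
  to : ∀ {m} (f : Fin m → Bool) → anyFin f ≡ true → ∃ λ y → f y ≡ true
  to {suc m} f eq with f fzero in f0
  ... | true  = fzero , f0
  ... | false = let (y , fy) = to (f ∘ fsuc) eq in fsuc y , fy
  from : ∀ {m} (f : Fin m → Bool) y → f y ≡ true → anyFin f ≡ true
  from f fzero fy rewrite fy = refl
  from f (fsuc y) fy rewrite from (f ∘ fsuc) y fy = ∨-zeroʳ (f fzero)

escapes : ∀ {n} (S T : Subset n) → ∣ T ∣ < ∣ S ∣ → ∃ λ x → x ∈ S × x ∉ T
escapes S T T<S with Finₚ.any? (λ x → (x ∈? S) ×-dec ¬? (x ∈? T))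
... | yes witness = witness
... | no none = contradiction (p⊆q⇒∣p∣≤∣q∣ S⊆T) (ℕₚ.<⇒≱ T<S)
  where
  S⊆T : S ⊆ T
  S⊆T {x} x∈S with x ∈? T
  ... | yes x∈T = x∈T
  ... | no x∉T = contradiction (x , x∈S , x∉T) none

nonempty : ∀ {n} (S : Subset n) → 1 ≤ ∣ S ∣ → Nonempty S
nonempty {n} S 1≤S =
  Product.map₂ proj₁ (escapes S ⊥ (subst (_< ∣ S ∣) (≡-sym (∣⊥∣≡0 n)) 1≤S))

another : ∀ {n} (S : Subset n) → 2 ≤ ∣ S ∣ → (c : Fin n) → ∃ λ x → x ∈ S × x ≢ c
another S 2≤S c =
  Product.map₂ (Product.map₂ x∉⁅y⁆⇒x≢y) (escapes S ⁅ c ⁆ (subst (_< ∣ S ∣) (≡-sym (∣⁅x⁆∣≡1 c)) 2≤S))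

∣p-x∣ : ∀ {n} (S : Subset n) x → x ∈ S → suc ∣ S - x ∣ ≡ ∣ S ∣
∣p-x∣ (inside ∷ S) fzero _ = cong suc (cong ∣_∣ (p─⊥≡p S))
∣p-x∣ (inside  ∷ S) (fsuc x) (there x∈S) = cong suc (∣p-x∣ S x x∈S)
∣p-x∣ (outside ∷ S) (fsuc x) (there x∈S) = ∣p-x∣ S x x∈S

member⇒1≤∣S∣ : ∀ {n} (S : Subset n) {y} → y ∈ S → 1 ≤ ∣ S ∣
member⇒1≤∣S∣ S {y} y∈S = subst (_≤ ∣ S ∣) (∣⁅x⁆∣≡1 y)
  (p⊆q⇒∣p∣≤∣q∣ λ z∈⁅y⁆ → subst (_∈ S) (≡-sym (x∈⁅y⁆⇒x≡y y z∈⁅y⁆)) y∈S)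

two≤∣S∣ : ∀ {n} (S : Subset n) {x y} → x ∈ S → y ∈ S → x ≢ y → 2 ≤ ∣ S ∣
two≤∣S∣ S {x} {y} x∈S y∈S x≢y =
  subst (2 ≤_) (∣p-x∣ S x x∈S) (s≤s (member⇒1≤∣S∣ (S - x) (x∈p∧x≢y⇒x∈p-y y∈S (x≢y ∘ ≡-sym))))

Least : ∀ {n} → (Fin n → Fin n → Set) → Subset n → Set
Least {n} R S = ∃ λ (x : Fin n) → x ∈ S × (∀ y → y ∈ S → R x y)

-- Induction on the excess k:
-- with y ∈ S, let m₁ be least in S - y and z ≢ m₁ another element of S - y;
-- a least element m₂ of S - z is then below everything in S - z, and below z
-- via m₂ R m₁ R z.
module LeastElements {n : ℕ} (R : Fin n → Fin n → Set)
  (R-trans : ∀ {x y z} → R x y → R y z → R x z)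
  {p : ℕ} (2≤p : 2 ≤ p) (least-p : ∀ (S : Subset n) → ∣ S ∣ ≡ p → Least R S) where

  2≤p+ : ∀ k → 2 ≤ p + k
  2≤p+ k = ℕₚ.≤-trans 2≤p (ℕₚ.m≤m+n p k)

  shrink : ∀ {k} {S : Subset n} {x} → ∣ S ∣ ≡ p + suc k → x ∈ S → ∣ S - x ∣ ≡ p + k
  shrink {k} {S} ∣S∣≡p+1+k x∈S =
    ℕₚ.suc-injective (trans (∣p-x∣ S _ x∈S) (trans ∣S∣≡p+1+k (ℕₚ.+-suc p k)))

  least+ : ∀ k (S : Subset n) → ∣ S ∣ ≡ p + k → Least R S
  least+ zero S ∣S∣≡p = least-p S (trans ∣S∣≡p (ℕₚ.+-identityʳ p))
  least+ (suc k) S ∣S∣≡p+1+k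
    with nonempty S (subst (1 ≤_) (≡-sym ∣S∣≡p+1+k) (ℕₚ.≤-trans (s≤s z≤n) (2≤p+ (suc k))))
  ... | y , y∈S
    with least+ k (S - y) (shrink ∣S∣≡p+1+k y∈S)
  ... | m₁ , m₁∈S-y , m₁-below
    with another (S - y) (subst (2 ≤_) (≡-sym (shrink ∣S∣≡p+1+k y∈S)) (2≤p+ k)) m₁
  ... | z , z∈S-y , z≢m₁
    with least+ k (S - z) (shrink ∣S∣≡p+1+k (p─q⊆p S ⁅ y ⁆ z∈S-y))
  ... | m₂ , m₂∈S-z , m₂-below = m₂ , p─q⊆p S ⁅ z ⁆ m₂∈S-z , below
    where
    m₂Rm₁ : R m₂ m₁
    m₂Rm₁ = m₂-below m₁ (x∈p∧x≢y⇒x∈p-y (p─q⊆p S ⁅ y ⁆ m₁∈S-y) (z≢m₁ ∘ ≡-sym))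
    below : ∀ w → w ∈ S → R m₂ w
    below w w∈S with w ≟ᶠ z
    ... | no w≢z = m₂-below w (x∈p∧x≢y⇒x∈p-y w∈S w≢z)
    ... | yes refl = R-trans m₂Rm₁ (m₁-below w z∈S-y)

  least : ∀ (S : Subset n) → p ≤ ∣ S ∣ → Least R S
  least S p≤∣S∣ = least+ (∣ S ∣ ∸ p) S (≡-sym (ℕₚ.m+[n∸m]≡n p≤∣S∣))

isLeft : ∀ {A B : Set} → A ⊎ B → Bool
isLeft = [ const true , const false ]′

split : ∀ {n} (S : Subset n) → Fin n → Fin ∣ S ∣ ⊎ Fin ∣ ∁ S ∣
split (inside  ∷ S) fzero    = inj₁ fzero
split (inside  ∷ S) (fsuc x) = Sum.map₁ fsuc (split S x)
split (outside ∷ S) fzero    = inj₂ fzero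
split (outside ∷ S) (fsuc x) = Sum.map₂ fsuc (split S x)

unsplit : ∀ {n} (S : Subset n) → Fin ∣ S ∣ ⊎ Fin ∣ ∁ S ∣ → Fin n
unsplit (inside  ∷ S) (inj₁ fzero)    = fzero
unsplit (inside  ∷ S) (inj₁ (fsuc i)) = fsuc (unsplit S (inj₁ i))
unsplit (inside  ∷ S) (inj₂ j)        = fsuc (unsplit S (inj₂ j))
unsplit (outside ∷ S) (inj₁ i)        = fsuc (unsplit S (inj₁ i))
unsplit (outside ∷ S) (inj₂ fzero)    = fzero
unsplit (outside ∷ S) (inj₂ (fsuc j)) = fsuc (unsplit S (inj₂ j))

split∘unsplit : ∀ {n} (S : Subset n) s → split S (unsplit S s) ≡ s
split∘unsplit (inside  ∷ S) (inj₁ fzero)    = refl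
split∘unsplit (inside  ∷ S) (inj₁ (fsuc i)) = cong (Sum.map₁ fsuc) (split∘unsplit S (inj₁ i))
split∘unsplit (inside  ∷ S) (inj₂ j)        = cong (Sum.map₁ fsuc) (split∘unsplit S (inj₂ j))
split∘unsplit (outside ∷ S) (inj₁ i)        = cong (Sum.map₂ fsuc) (split∘unsplit S (inj₁ i))
split∘unsplit (outside ∷ S) (inj₂ fzero)    = refl
split∘unsplit (outside ∷ S) (inj₂ (fsuc j)) = cong (Sum.map₂ fsuc) (split∘unsplit S (inj₂ j))

unsplit∘split : ∀ {n} (S : Subset n) x → unsplit S (split S x) ≡ x
unsplit∘split (inside  ∷ S) fzero    = refl
unsplit∘split (outside ∷ S) fzero    = refl
unsplit∘split (inside  ∷ S) (fsuc x) with split S x | unsplit∘split S x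
... | inj₁ _ | eq = cong fsuc eq
... | inj₂ _ | eq = cong fsuc eq
unsplit∘split (outside ∷ S) (fsuc x) with split S x | unsplit∘split S x
... | inj₁ _ | eq = cong fsuc eq
... | inj₂ _ | eq = cong fsuc eq

isLeft-split : ∀ {n} (S : Subset n) x → isLeft (split S x) ≡ lookup S x
isLeft-split (inside  ∷ S) fzero    = refl
isLeft-split (outside ∷ S) fzero    = refl
isLeft-split (inside  ∷ S) (fsuc x) with split S x | isLeft-split S x
... | inj₁ _ | eq = eq
... | inj₂ _ | eq = eq
isLeft-split (outside ∷ S) (fsuc x) with split S x | isLeft-split S x
... | inj₁ _ | eq = eq
... | inj₂ _ | eq = eq

r+k<ᵇr : ∀ r k → (r + k <ᵇ r) ≡ false
r+k<ᵇr zero    k = refl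
r+k<ᵇr (suc r) k = r+k<ᵇr r k

isLeft-join : ∀ r q (s : Fin r ⊎ Fin q) → (toℕ (join r q s) <ᵇ r) ≡ isLeft s
isLeft-join r q (inj₁ i) rewrite Finₚ.toℕ-↑ˡ i q = Equivalence.to T-≡ (ℕₚ.<⇒<ᵇ (Finₚ.toℕ<n i))
isLeft-join r q (inj₂ j) rewrite Finₚ.toℕ-↑ʳ r j = r+k<ᵇr r (toℕ j)

partition : ∀ {n} (S : Subset n) → Fin n ↔ Fin (∣ S ∣ + ∣ ∁ S ∣)
partition S = mk↔ₛ′ (join _ _ ∘ split S) (unsplit S ∘ splitAt _)
  (λ i → trans (cong (join _ _) (split∘unsplit S (splitAt _ i))) (Finₚ.join-splitAt ∣ S ∣ ∣ ∁ S ∣ i))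
  (λ x → trans (cong (unsplit S) (Finₚ.splitAt-join _ _ (split S x))) (unsplit∘split S x))

partition-inside : ∀ {n} (S : Subset n) x →
  (toℕ (Inverse.to (partition S) x) <ᵇ ∣ S ∣) ≡ lookup S x
partition-inside S x = trans (isLeft-join _ _ (split S x)) (isLeft-split S x)

KI-adj-loop : ∀ r q (i : Fin (r + q)) → KI-adj r q i i ≡ false
KI-adj-loop r q i rewrite dec-true (i ≟ᶠ i) refl =
  trans (cong ((toℕ i <ᵇ r) ∧_) (∧-zeroʳ _)) (∧-zeroʳ _)

KI-adj-distinct : ∀ r q {i j : Fin (r + q)} → i ≢ j →
  KI-adj r q i j ≡ (toℕ i <ᵇ r) ∧ (toℕ j <ᵇ r)
KI-adj-distinct r q {i} {j} i≢j rewrite dec-false (i ≟ᶠ j) i≢j =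
  cong ((toℕ i <ᵇ r) ∧_) (∧-identityʳ _)

∧-reflects : ∀ {b u v : Bool} {P Q : Set} → b ≡ u ∧ v →
  u ≡ true ⇔ P → v ≡ true ⇔ Q → b ≡ true ⇔ (P × Q)
∧-reflects refl u⇔P v⇔Q = ⇔.trans ∧-≡true (u⇔P ×-⇔ v⇔Q)

CliqueOn : ∀ {n} → Graph n → Subset n → Set
CliqueOn {n} G K = ∀ (x y : Fin n) → x ≢ y → adj G x y ≡ true ⇔ (x ∈ K × y ∈ K)

cliqueOn⇒IsoKI : ∀ {n} (G : Graph n) (K : Subset n) → CliqueOn G K → IsoKI G ∣ K ∣ ∣ ∁ K ∣
cliqueOn⇒IsoKI G K clique = partition K , edges
  where
  φ : Fin _ → Fin (∣ K ∣ + ∣ ∁ K ∣)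
  φ = Inverse.to (partition K)
  φ-injective : ∀ {x y} → φ x ≡ φ y → x ≡ y
  φ-injective = Injection.injective (↔⇒↣ (partition K))
  edges : ∀ x y → adj G x y ≡ KI-adj ∣ K ∣ ∣ ∁ K ∣ (φ x) (φ y)
  edges x y with x ≟ᶠ y
  ... | yes refl = trans (irrefl G x) (≡-sym (KI-adj-loop ∣ K ∣ ∣ ∁ K ∣ (φ x)))
  ... | no x≢y = begin
    adj G x y
      ≡⟨ ⇔→≡ (⇔.trans (clique x y x≢y) (⇔.sym (∧-reflects refl (lookup⇔∈ K x) (lookup⇔∈ K y)))) ⟩
    lookup K x ∧ lookup K y
      ≡⟨ cong₂ _∧_ (partition-inside K x) (partition-inside K y) ⟨
    (toℕ (φ x) <ᵇ ∣ K ∣) ∧ (toℕ (φ y) <ᵇ ∣ K ∣)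
      ≡⟨ KI-adj-distinct ∣ K ∣ ∣ ∁ K ∣ (x≢y ∘ φ-injective) ⟨
    KI-adj ∣ K ∣ ∣ ∁ K ∣ (φ x) (φ y) ∎
    where open ≡-Reasoning

module FromIso {n r q : ℕ} {G : Graph n} (iso : IsoKI G r q) where

  ψ : Fin n ↔ Fin (r + q)
  ψ = proj₁ iso

  K : Subset n
  K = tabulate (λ x → toℕ (Inverse.to ψ x) <ᵇ r)

  cliqueOn : CliqueOn G K
  cliqueOn x y x≢y = ∧-reflects
    (trans (proj₂ iso x y) (KI-adj-distinct r q (x≢y ∘ Injection.injective (↔⇒↣ ψ))))
    (tabulate⇔∈ _ x) (tabulate⇔∈ _ y)

  isolated : Fin q → Fin n
  isolated j = Inverse.from ψ (r ↑ʳ j)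

  isolated∉K : ∀ j → isolated j ∉ K
  isolated∉K j j∈K = false≢true (begin
    false                                      ≡⟨ isLeft-join r q (inj₂ j) ⟨
    toℕ (r ↑ʳ j) <ᵇ r                          ≡⟨ cong (λ i → toℕ i <ᵇ r) (Inverse.strictlyInverseˡ ψ (r ↑ʳ j)) ⟨
    toℕ (Inverse.to ψ (isolated j)) <ᵇ r       ≡⟨ Equivalence.from (tabulate⇔∈ _ (isolated j)) j∈K ⟩
    true                                       ∎)
    where
    open ≡-Reasoning
    false≢true : false ≢ true
    false≢true ()

  isolated-injective : ∀ {i j} → isolated i ≡ isolated j → i ≡ j
  isolated-injective {i} {j} eq =
    Finₚ.↑ʳ-injective r i j (Injection.injective (↔⇒↣ (↔-sym ψ)) eq)

does⇔ : ∀ {P : Set} (P? : Dec P) → does P? ≡ true ⇔ P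
does⇔ (yes P) = mk⇔ (const P) (const refl)
does⇔ (no ¬P) = mk⇔ (λ ()) (λ P → contradiction P ¬P)

-- Two vertices then have a common prey and a common enemy iff both
-- lie in K (a is the common prey, b the common enemy).
module Construction {n : ℕ} (K : Subset n) (a b : Fin n)
  (a∉K : a ∉ K) (b∉K : b ∉ K) (a≢b : a ≢ b) where

  Source Target : Fin n → Set
  Source x = x ∈ K ⊎ x ≡ b
  Target y = y ∈ K ⊎ y ≡ a

  Arc : Fin n → Fin n → Set
  Arc x y = Source x × Target y × (x ≡ b ⊎ y ≡ a)

  source? : ∀ x → Dec (Source x)
  source? x = (x ∈? K) ⊎-dec (x ≟ᶠ b)

  arc? : ∀ x y → Dec (Arc x y)
  arc? x y = source? x ×-dec ((y ∈? K) ⊎-dec (y ≟ᶠ a)) ×-dec ((x ≟ᶠ b) ⊎-dec (y ≟ᶠ a))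

  D : Digraph n
  D x y = does (arc? x y)

  arc⇔ : ∀ x y → D x y ≡ true ⇔ Arc x y
  arc⇔ x y = does⇔ (arc? x y)

  prey⇔ : ∀ x y → y ∈ N⁺ D x ⇔ Arc x y
  prey⇔ x y = ⇔.trans (⇔.sym (tabulate⇔∈ (D x) y)) (arc⇔ x y)

  enemy⇔ : ∀ x y → x ∈ N⁻ D y ⇔ Arc x y
  enemy⇔ x y = ⇔.trans (⇔.sym (tabulate⇔∈ (λ v → D v y) x)) (arc⇔ x y)

  noLoop : ∀ x → ¬ Arc x x
  noLoop x (_ , inj₁ b∈K , inj₁ refl) = b∉K b∈K
  noLoop x (_ , inj₂ b≡a , inj₁ refl) = a≢b (≡-sym b≡a)
  noLoop x (inj₁ a∈K , _ , inj₂ refl) = a∉K a∈K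
  noLoop x (inj₂ a≡b , _ , inj₂ refl) = a≢b a≡b

  loopless : Loopless D
  loopless x = dec-false (arc? x x) (noLoop x)

  preyAndEnemy⇒∈K : ∀ {x w u} → Arc x w → Arc u x → x ∈ K
  preyAndEnemy⇒∈K (inj₁ x∈K , _) _ = x∈K
  preyAndEnemy⇒∈K (inj₂ refl , _) (_ , inj₁ b∈K , _) = contradiction b∈K b∉K
  preyAndEnemy⇒∈K (inj₂ refl , _) (_ , inj₂ b≡a , _) = contradiction (≡-sym b≡a) a≢b

  cce : (G : Graph n) → CliqueOn G K → IsCCEGraph G D
  cce G clique x y x≢y = common , adjacent
    where
    prey-a : ∀ {v} → v ∈ K → a ∈ N⁺ D v
    prey-a v∈K = Equivalence.from (prey⇔ _ a) (inj₁ v∈K , inj₂ refl , inj₂ refl)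
    enemy-b : ∀ {v} → v ∈ K → b ∈ N⁻ D v
    enemy-b v∈K = Equivalence.from (enemy⇔ b _) (inj₂ refl , inj₁ v∈K , inj₁ refl)
    common : adj G x y ≡ true → Nonempty (N⁺ D x ∩ N⁺ D y) × Nonempty (N⁻ D x ∩ N⁻ D y)
    common xy with Equivalence.to (clique x y x≢y) xy
    ... | x∈K , y∈K = (a , x∈p∩q⁺ (prey-a x∈K , prey-a y∈K)) , (b , x∈p∩q⁺ (enemy-b x∈K , enemy-b y∈K))
    adjacent : Nonempty (N⁺ D x ∩ N⁺ D y) × Nonempty (N⁻ D x ∩ N⁻ D y) → adj G x y ≡ true
    adjacent ((w , w∈) , (u , u∈)) with x∈p∩q⁻ (N⁺ D x) (N⁺ D y) w∈ | x∈p∩q⁻ (N⁻ D x) (N⁻ D y) u∈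
    ... | w∈x , w∈y | u∈x , u∈y = Equivalence.from (clique x y x≢y) (inK x w∈x u∈x , inK y w∈y u∈y)
      where
      inK : ∀ v {w u} → w ∈ N⁺ D v → u ∈ N⁻ D v → v ∈ K
      inK v w∈ u∈ = preyAndEnemy⇒∈K (Equivalence.to (prey⇔ v _) w∈) (Equivalence.to (enemy⇔ _ v) u∈)

  -- In a set S of at least two vertices, a vertex that is not a source has no
  -- prey at all; if every vertex of S is a source, any x ∈ S other than b has
  -- only a as prey, and a is a prey of every source.
  condC : ∀ {p} → 2 ≤ p → CondC p D
  condC 2≤p S ∣S∣≡p with Finₚ.any? (λ x → (x ∈? S) ×-dec ¬? (source? x))
  ... | yes (x , x∈S , ¬source) =
    x , x∈S , λ _ _ v∈ → contradiction (proj₁ (Equivalence.to (prey⇔ x _) v∈)) ¬source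
  ... | no noNonSource with another S (subst (2 ≤_) (≡-sym ∣S∣≡p) 2≤p) b
  ...   | x , x∈S , x≢b = x , x∈S , λ y y∈S v∈ → onlyA (Equivalence.to (prey⇔ x _) v∈) y (sources y∈S)
    where
    sources : ∀ {y} → y ∈ S → Source y
    sources {y} y∈S with source? y
    ... | yes source = source
    ... | no ¬source = contradiction (y , y∈S , ¬source) noNonSource
    onlyA : ∀ {v} → Arc x v → ∀ y → Source y → v ∈ N⁺ D y
    onlyA (_ , _ , inj₁ x≡b) _ _ = contradiction x≡b x≢b
    onlyA (_ , _ , inj₂ refl) y source = Equivalence.from (prey⇔ y a) (source , inj₂ refl , inj₂ refl)

-- Reversing all arcs exchanges prey and enemies: N⁺ (converse D) = N⁻ D
-- definitionally, so C'(p) for D is C(p) for its converse.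
converse : ∀ {n} → Digraph n → Digraph n
converse D x y = D y x

cce-converse : ∀ {n} {G : Graph n} {D : Digraph n} → IsCCEGraph G D → IsCCEGraph G (converse D)
cce-converse cce x y x≢y = swap ∘ proj₁ (cce x y x≢y) , proj₂ (cce x y x≢y) ∘ swap

condC-≗ : ∀ {n p} {D E : Digraph n} → (∀ x y → D x y ≡ E x y) → CondC p D → CondC p E
condC-≗ {D = D} {E} D≗E condC S ∣S∣≡p with condC S ∣S∣≡p
... | x , x∈S , below = x , x∈S , λ y y∈S → subst₂ _⊆_ (N⁺-≡ x) (N⁺-≡ y) (below y y∈S)
  where
  N⁺-≡ : ∀ v → N⁺ D v ≡ N⁺ E v
  N⁺-≡ v = tabulate-cong (D≗E v)

-- The
-- converse of the construction for (a, b) is the construction for (b, a).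
realize : ∀ {n p} (G : Graph n) (K : Subset n) → CliqueOn G K → 2 ≤ p →
  ∀ {a b} → a ∉ K → b ∉ K → a ≢ b →
  ∃ λ (D : Digraph n) → Loopless D × CondC p D × CondC' p D × IsCCEGraph G D
realize {p = p} G K clique 2≤p {a} {b} a∉K b∉K a≢b =
  D , loopless , condC 2≤p , condC' , cce G clique
  where
  open Construction K a b a∉K b∉K a≢b
  module Mirror = Construction K b a b∉K a∉K (a≢b ∘ ≡-sym)
  mirror : ∀ x y → Mirror.D x y ≡ converse D x y
  mirror x y = ⇔→≡ (⇔.trans (Mirror.arc⇔ x y) (⇔.trans reverse (⇔.sym (arc⇔ y x))))
    where
    reverse : Mirror.Arc x y ⇔ Arc y x
    reverse = mk⇔ (λ (s , t , o) → t , s , Sum.swap o) (λ (s , t , o) → t , s , Sum.swap o)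
  condC' : CondC' p D
  condC' = condC-≗ mirror (Mirror.condC 2≤p)

nonIsolated⇔ : ∀ {n} (G : Graph n) x → x ∈ nonIsolated G ⇔ ∃ λ y → adj G x y ≡ true
nonIsolated⇔ G x = ⇔.trans (⇔.sym (tabulate⇔∈ _ x)) (anyFin⇔∃ (adj G x))

adj⇒≢ : ∀ {n} (G : Graph n) {x y} → adj G x y ≡ true → x ≢ y
adj⇒≢ G {x} xy refl with () ← trans (≡-sym (irrefl G x)) xy

hasPrey : ∀ {n} {G : Graph n} {D : Digraph n} → IsCCEGraph G D →
  ∀ {x} → x ∈ nonIsolated G → Nonempty (N⁺ D x)
hasPrey {G = G} {D} cce {x} x∈W with Equivalence.to (nonIsolated⇔ G x) x∈W
... | y , xy with proj₁ (cce x y (adj⇒≢ G xy)) xy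
...   | (v , v∈x∩y) , _ = v , proj₁ (x∈p∩q⁻ (N⁺ D x) (N⁺ D y) v∈x∩y)

leastPrey : ∀ {n p} {D : Digraph n} → 2 ≤ p → CondC p D →
  ∀ (S : Subset n) → p ≤ ∣ S ∣ → F⁺Nonempty D S
leastPrey {D = D} 2≤p condC =
  LeastElements.least (λ x y → N⁺ D x ⊆ N⁺ D y) (λ f g v∈ → g (f v∈)) 2≤p condC

commonPrey : ∀ {n p} {G : Graph n} {D : Digraph n} → 2 ≤ p → p ≤ ∣ nonIsolated G ∣ →
  CondC p D → IsCCEGraph G D → ∃ λ a → ∀ x → x ∈ nonIsolated G → a ∈ N⁺ D x
commonPrey {G = G} 2≤p p≤W condC cce with leastPrey 2≤p condC (nonIsolated G) p≤W
... | m , m∈W , m-below with hasPrey {G = G} cce m∈W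
...   | a , a∈m = a , λ x x∈W → m-below x x∈W a∈m

enemy⇒prey : ∀ {n} (D : Digraph n) {u w} → u ∈ N⁻ D w → w ∈ N⁺ D u
enemy⇒prey D {u} {w} u∈ =
  Equivalence.to (tabulate⇔∈ (D u) w) (Equivalence.from (tabulate⇔∈ (λ v → D v w) u) u∈)

noSelfPrey : ∀ {n} {D : Digraph n} → Loopless D → ∀ v → v ∉ N⁺ D v
noSelfPrey {D = D} loopless v v∈
  with () ← trans (≡-sym (loopless v)) (Equivalence.from (tabulate⇔∈ (D v) v) v∈)

-- A loopless digraph with C(p) on at least p vertices has a vertex without prey:
-- the least vertex z satisfies N⁺ z ⊆ N⁺ v, so v ∈ N⁺ z would make v its own prey.
preyless : ∀ {n p} {D : Digraph n} → Loopless D → 2 ≤ p → p ≤ n → CondC p D →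
  ∃ λ z → ∀ v → v ∉ N⁺ D z
preyless {n} {D = D} loopless 2≤p p≤n condC
  with leastPrey 2≤p condC ⊤ (subst (_ ≤_) (≡-sym (∣⊤∣≡n n)) p≤n)
... | z , _ , z-below = z , λ v v∈z → noSelfPrey {D = D} loopless v (z-below v ∈⊤ v∈z)

-- Forward direction: for a loopless D with C(p), C'(p) and CCE graph G having
-- at least p non-isolated vertices W, the set W is a clique (its members share
-- the prey a and the enemy b) and G has two isolated vertices: b (it would be
-- its own enemy) and a vertex z without prey (z ≢ b since b preys on W).
module Forward {n p : ℕ} {G : Graph n} {D : Digraph n} (2≤p : 2 ≤ p) (p≤W : p ≤ ∣ nonIsolated G ∣)
  (loopless : Loopless D) (condC : CondC p D) (condC' : CondC' p D) (cce : IsCCEGraph G D) where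

  W : Subset n
  W = nonIsolated G

  prey : ∃ λ a → ∀ x → x ∈ W → a ∈ N⁺ D x
  prey = commonPrey {G = G} 2≤p p≤W condC cce

  enemy : ∃ λ b → ∀ x → x ∈ W → b ∈ N⁻ D x
  enemy = commonPrey {G = G} {D = converse D} 2≤p p≤W condC' (cce-converse {G = G} cce)

  b : Fin n
  b = proj₁ enemy

  cliqueOn : CliqueOn G W
  cliqueOn x y x≢y = mk⇔
    (λ xy → inW xy , inW (trans (Graph.sym G y x) xy))
    (λ (x∈W , y∈W) → proj₂ (cce x y x≢y)
      ( (proj₁ prey , x∈p∩q⁺ (proj₂ prey x x∈W , proj₂ prey y y∈W))
      , (b , x∈p∩q⁺ (proj₂ enemy x x∈W , proj₂ enemy y y∈W))))
    where
    inW : ∀ {u v} → adj G u v ≡ true → u ∈ W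
    inW uv = Equivalence.from (nonIsolated⇔ G _) (_ , uv)

  twoIsolated : 2 ≤ ∣ ∁ W ∣
  twoIsolated with preyless loopless 2≤p (ℕₚ.≤-trans p≤W (∣p∣≤n W)) condC
                 | nonempty W (ℕₚ.≤-trans (s≤s z≤n) (ℕₚ.≤-trans 2≤p p≤W))
  ... | z , z-noPrey | w , w∈W = two≤∣S∣ (∁ W) (x∉p⇒x∈∁p z∉W) (x∉p⇒x∈∁p b∉W) z≢b
    where
    z∉W : z ∉ W
    z∉W z∈W = z-noPrey _ (proj₂ (hasPrey {G = G} cce z∈W))
    b∉W : b ∉ W
    b∉W b∈W = noSelfPrey {D = D} loopless b (enemy⇒prey D (proj₂ enemy b b∈W))
    z≢b : z ≢ b
    z≢b z≡b = z-noPrey w (subst (λ u → w ∈ N⁺ D u) (≡-sym z≡b) (enemy⇒prey D (proj₂ enemy w w∈W)))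

forward : ∀ {n p} (G : Graph n) → 2 ≤ p → p ≤ ∣ nonIsolated G ∣ →
  (∃ λ (D : Digraph n) → Loopless D × CondC p D × CondC' p D × IsCCEGraph G D) →
  ∃₂ λ (r q : ℕ) → p ≤ r × 2 ≤ q × IsoKI G r q
forward G 2≤p p≤W (D , loopless , condC , condC' , cce) =
  ∣ W ∣ , ∣ ∁ W ∣ , p≤W , twoIsolated , cliqueOn⇒IsoKI G W cliqueOn
  where open Forward {G = G} {D = D} 2≤p p≤W loopless condC condC' cce

backward : ∀ {n p} (G : Graph n) → 2 ≤ p →
  (∃₂ λ (r q : ℕ) → p ≤ r × 2 ≤ q × IsoKI G r q) →
  ∃ λ (D : Digraph n) → Loopless D × CondC p D × CondC' p D × IsCCEGraph G D
backward G 2≤p (_ , suc zero , _ , s≤s () , _)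
backward G 2≤p (r , suc (suc q) , _ , _ , iso) =
  realize G K cliqueOn 2≤p (isolated∉K fzero) (isolated∉K (fsuc fzero)) (0≢1 ∘ isolated-injective)
  where
  open FromIso {r = r} {q = suc (suc q)} {G = G} iso
  0≢1 : fzero {suc q} ≢ fsuc fzero
  0≢1 ()

theorem2p6 : ∀ {n : ℕ} (G : Graph n) (p : ℕ) → 2 ≤ p → p ≤ ∣ nonIsolated G ∣ →
    (∃ λ (D : Digraph n) → Loopless D × CondC p D × CondC' p D × IsCCEGraph G D)
    ⇔ (∃₂ λ (r q : ℕ) → p ≤ r × 2 ≤ q × IsoKI G r q)
theorem2p6 G p 2≤p p≤W = mk⇔ (forward G 2≤p p≤W) (backward G 2≤p)
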